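{- $\mathtt{CONST}\text{ - }\mathtt{LIN}_{\mathtt{succ}}\subsetneq\mathtt{CONST}\text{ - }\mathtt{LIN}$.
   Context: RAM with operation set $\mathtt{Op}$: registers holding natural numbers (accumulator $A$, buffer $B$, work registers $R[0],R[1],\dots$ initialized to $0$, input size register $N$, input registers $I[0],\dots,I[N-1]$ with contents at most $cN$); instructions $A\gets j$ (constant), $B\gets A$, $R[A]\gets B$, $A\gets R[A]$, conditional jump on $A=0$, $A\gets N$, $A\gets I[A]$, output, and $A\gets\mathtt{op}(A)$ or $\mathtt{op}(A,B)$ for $\mathtt{op}\in\mathtt{Op}$; unit cost per instruction; register contents and addresses $O(N)$. $\mathtt{CONST}\text{ - }\mathtt{LIN}$ is the class of "dynamic" problems $(\mathcal I,\mathcal X)\mapsto f(\mathcal I,\mathcal X)$ for which some RAM with operation set $\{+\}$ (addition), from an input $\mathcal I$ of size $N$, computes an index $p(\mathcal I)$ in time $O(N)$, and then, reading a second input $\mathcal X$ of constant size, computes $f(\mathcal I,\mathcal X)$ from $p(\mathcal I)$ in constant time. $\mathtt{CONST}\text{ - }\mathtt{LIN}_{\mathtt{succ}}$ is the same class defined with RAMs whose only primitive operations are the successor $x\mapsto x+1$ and predecessor $x\mapsto x-1$ (for $x<cN$, $c$ a constant) instead of addition. -}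

module Defs where

open import Data.Nat using (ℕ; zero; suc; _+_; _*_; _∸_; _≤_; _≡ᵇ_)
open import Data.Bool using (if_then_else_)
open import Data.List using (List; []; _∷_; _++_)
open import Data.Maybe using (Maybe; just; nothing)
open import Data.Vec using (Vec)
import Data.Vec as Vec
open import Data.Vec.Relation.Unary.All using (All)
open import Data.Product using (Σ; _×_; _,_)
open import Relation.Binary.PropositionalEquality using (_≡_)

-- Operation sets.  An operation is applied as  A ← op(A,B);
-- unary operations simply ignore B.

record OpSet : Set₁ where
  field
    Op   : Set
    eval : Op → ℕ → ℕ → ℕ
open OpSet public

data PlusOp : Set where
  plus : PlusOp

Plus : OpSet
Plus = record { Op = PlusOp ; eval = λ { plus a b → a + b } }

-- {succ, pred} : successor x ↦ x+1 and predecessor x ↦ x ∸ 1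
-- (the restriction "x < cN" is enforced by the global O(N) bound on
-- register contents required of every RAM below)
data SuccPredOp : Set where
  succ pred : SuccPredOp

SuccPred : OpSet
SuccPred = record { Op = SuccPredOp
                  ; eval = λ { succ a b → suc a ; pred a b → a ∸ 1 } }

data Instr (O : OpSet) : Set where
  setA   : ℕ → Instr O
  movB   : Instr O
  store  : Instr O
  load   : Instr O
  jz     : ℕ → Instr O
  readN  : Instr O
  readI  : Instr O
  output : Instr O
  apply  : Op O → Instr O

Program : OpSet → Set
Program O = List (Instr O)

fetch : {X : Set} → List X → ℕ → Maybe X
fetch []       _       = nothing
fetch (x ∷ xs) zero    = just x
fetch (x ∷ xs) (suc n) = fetch xs n

record Config : Set where
  constructor cfg
  field
    pc   : ℕ
    A    : ℕ
    B    : ℕ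
    R    : ℕ → ℕ
    outs : List ℕ
open Config public

initConfig : Config
initConfig = cfg 0 0 0 (λ _ → 0) []

-- input registers as a function; out-of-range reads give 0
readVec : {n : ℕ} → Vec ℕ n → ℕ → ℕ
readVec {zero}  _        _       = 0
readVec {suc n} v        zero    = Vec.head v
readVec {suc n} v        (suc i) = readVec (Vec.tail v) i

exec : (O : OpSet) → ℕ → (ℕ → ℕ) → Instr O → Config → Config
exec O N inp (setA j) (cfg p a b r o) = cfg (suc p) j b r o
exec O N inp movB     (cfg p a b r o) = cfg (suc p) a a r o
exec O N inp store    (cfg p a b r o) =
  cfg (suc p) a b (λ i → if i ≡ᵇ a then b else r i) o
exec O N inp load     (cfg p a b r o) = cfg (suc p) (r a) b r o
exec O N inp (jz ℓ)   (cfg p zero b r o)    = cfg ℓ zero b r o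
exec O N inp (jz ℓ)   (cfg p (suc a) b r o) = cfg (suc p) (suc a) b r o
exec O N inp readN    (cfg p a b r o) = cfg (suc p) N b r o
exec O N inp readI    (cfg p a b r o) = cfg (suc p) (inp a) b r o
exec O N inp output   (cfg p a b r o) = cfg (suc p) a b r (o ++ (a ∷ []))
exec O N inp (apply f) (cfg p a b r o) = cfg (suc p) (eval O f a b) b r o

-- one step (a halted configuration, pc outside the program, is fixed)
step : (O : OpSet) → Program O → ℕ → (ℕ → ℕ) → Config → Config
step O P N inp c with fetch P (pc c)
... | nothing = c
... | just i  = exec O N inp i c

run : (O : OpSet) → Program O → ℕ → (ℕ → ℕ) → ℕ → Config → Config
run O P N inp zero    c = c
run O P N inp (suc t) c = run O P N inp t (step O P N inp c)

Halted : {O : OpSet} → Program O → Config → Set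
Halted P c = fetch P (pc c) ≡ nothing

-- Starting from c, program P (input size N, input registers inp) halts
-- within T steps in configuration d, and all values held in A and B
-- (hence all register contents and all addresses) stay ≤ bound.
RunsTo : (O : OpSet) → Program O → ℕ → (ℕ → ℕ) → Config → ℕ → ℕ → Config → Set
RunsTo O P N inp c T bound d =
  Σ ℕ λ t → t ≤ T × Halted P (run O P N inp t c) × run O P N inp t c ≡ d
    × (∀ s → s ≤ t → A (run O P N inp s c) ≤ bound × B (run O P N inp s c) ≤ bound)

-- Dynamic problems: first input I of size N (entries ≤ cN), second
-- input X of constant size d (entries ≤ cN); answer is a list of numbers.

Problem : ℕ → Set
Problem d = (N : ℕ) → Vec ℕ N → Vec ℕ d → List ℕ

Bounded : ℕ → ℕ → {n : ℕ} → Vec ℕ n → Set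
Bounded c N v = All (λ x → x ≤ c * N) v

-- start of the second phase: the memory R computed by preprocessing
-- (the "index" p(I)) is kept; pc, A, B and the output are reset.
phase2 : Config → Config
phase2 c = cfg 0 0 0 (R c) []

-- CONST-LIN for operation set O: a preprocessing program P₁ running in
-- time O(N) on I, followed by a program P₂ which, on the memory left by
-- P₁ and reading X in its input registers, computes f(I,X) in constant
-- time; register contents/addresses O(N) throughout.
ConstLin : (O : OpSet) → (c d : ℕ) → Problem d → Set
ConstLin O c d f =
  Σ (Program O) λ P₁ → Σ (Program O) λ P₂ → Σ ℕ λ K →
    ∀ N (I : Vec ℕ N) → Bounded c N I →
      Σ Config λ σ → RunsTo O P₁ N (readVec I) initConfig (K * suc N) (K * suc N) σ
        × (∀ (X : Vec ℕ d) → Bounded c N X →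
             Σ Config λ τ → RunsTo O P₂ N (readVec X) (phase2 σ) K (K * suc N) τ
               × outs τ ≡ f N I X)

CONST-LIN : (c d : ℕ) → Problem d → Set
CONST-LIN = ConstLin Plus

CONST-LIN-succ : (c d : ℕ) → Problem d → Set
CONST-LIN-succ = ConstLin SuccPred

-- With +, the sum of the two query inputs is computed in constant time without preprocessing.
-- With only successor and predecessor, every value a program can hold after t query steps is
-- G x or G y for G in a family of functions whose size depends only on the program and t, not on
-- N or on the preprocessed memory (registers not yet written keep their preprocessed contents).
-- For query time K the family has some size C, and a pigeonhole count gives x, y ≤ C² + 2C with
-- x + y different from every G x and G y, so x + y cannot be output.
--
-- Conversely, a +-RAM simulates a succ/pred-RAM instruction by instruction, in blocks of at most
-- 16 instructions: successor is addition of 1, and predecessor is a lookup in a table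
-- v ↦ v ∸ 1 for v ≤ M = (K + 1)(N + 1), built in linear time by a prologue of the preprocessing;
-- the simulated memory is shifted to make room for the table and a few scratch cells.

module Submission where

open import Defs
open import Data.Nat using (ℕ; zero; suc; _+_; _*_; _∸_; _≤_; _<_; _≡ᵇ_; z≤n; s≤s; s≤s⁻¹)
open import Data.Nat.Properties
open import Algebra.Properties.CommutativeSemigroup +-commutativeSemigroup using (x∙yz≈y∙xz)
open import Data.Bool using (true; false; if_then_else_; T)
open import Data.Maybe using (just; nothing)
open import Data.List using (List; []; _∷_; _++_; map; length; replicate; take; drop)
open import Data.List.Properties using (length-map; length-++; length-replicate)
open import Data.List.Relation.Unary.Any as Any using (Any; here; there; index)
open import Data.List.Relation.Unary.Any.Properties using (map⁺; Any-⊎⁻)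
open import Data.List.Relation.Unary.All as All using (All; []; _∷_)
import Data.List.Relation.Unary.All.Properties as All
open import Data.List.Relation.Binary.Subset.Propositional using (_⊆_)
open import Data.List.Relation.Binary.Subset.Propositional.Properties
  using (Any-resp-⊆; xs⊆xs++ys; xs⊆ys++xs)
open import Data.List.Membership.Propositional using (_∈_; _∉_)
open import Data.List.Membership.DecPropositional _≟_ using (_∈?_)
open import Data.List.Membership.Setoid.Properties using (index-injective)
open import Data.Fin using (Fin; toℕ)
open import Data.Fin.Properties using (pigeonhole; toℕ<n; any?)
open import Data.Vec using (Vec; []; _∷_)
import Data.Vec as Vec
import Data.Vec.Relation.Unary.All as VecAll
open import Data.Product using (Σ; ∃-syntax; ∃₂; _×_; _,_; proj₁; proj₂)
open import Data.Sum using (_⊎_; inj₁; inj₂; [_,_]′)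
import Data.Sum as Sum
open import Data.Unit using (⊤; tt)
open import Data.Empty using (⊥; ⊥-elim)
open import Function using (_∘_)
open import Relation.Nullary using (¬_; yes; no; ¬?)
open import Relation.Nullary.Decidable using (decidable-stable)
open import Relation.Binary.PropositionalEquality
open import Data.Nat.Tactic.RingSolver using (solve-∀)

-- Program fragments and bounded runs

if-≡ᵇ-≡ : ∀ {X : Set} {i a} {u w : X} → i ≡ a → (if i ≡ᵇ a then u else w) ≡ u
if-≡ᵇ-≡ {i = i} refl with i ≡ᵇ i in eq
... | true  = refl
... | false = ⊥-elim (subst T eq (≡⇒≡ᵇ i i refl))

if-≡ᵇ-≢ : ∀ {X : Set} {i a} {u w : X} → i ≢ a → (if i ≡ᵇ a then u else w) ≡ w
if-≡ᵇ-≢ {i = i} {a} i≢a with i ≡ᵇ a in eq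
... | true  = ⊥-elim (i≢a (≡ᵇ⇒≡ i a (subst T (sym eq) tt)))
... | false = refl

module _ {X : Set} where

  fetch-++ˡ : ∀ (xs ys : List X) {n i} → fetch xs n ≡ just i → fetch (xs ++ ys) n ≡ just i
  fetch-++ˡ (x ∷ xs) ys {zero}  eq = eq
  fetch-++ˡ (x ∷ xs) ys {suc n} eq = fetch-++ˡ xs ys eq

  fetch-++ʳ : ∀ (xs ys : List X) n → fetch (xs ++ ys) (length xs + n) ≡ fetch ys n
  fetch-++ʳ []       ys n = refl
  fetch-++ʳ (x ∷ xs) ys n = fetch-++ʳ xs ys n

  fetch-beyond : ∀ (xs : List X) {n} → length xs ≤ n → fetch xs n ≡ nothing
  fetch-beyond []       _         = refl
  fetch-beyond (x ∷ xs) (s≤s len≤n) = fetch-beyond xs len≤n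

  fetch-drop : ∀ n (xs : List X) k → fetch (drop n xs) k ≡ fetch xs (n + k)
  fetch-drop zero    xs       k = refl
  fetch-drop (suc n) []       k = refl
  fetch-drop (suc n) (x ∷ xs) k = fetch-drop n xs k

  fetch-take : ∀ n (xs : List X) {k i} → fetch (take n xs) k ≡ just i → fetch xs k ≡ just i
  fetch-take (suc n) (x ∷ xs) {zero}  eq = eq
  fetch-take (suc n) (x ∷ xs) {suc k} eq = fetch-take n xs eq

  record Placed (Q : List X) (p : ℕ) (m : List X) : Set where
    constructor placed
    field fetch-placed : ∀ k {i} → fetch m k ≡ just i → fetch Q (k + p) ≡ just i
  open Placed

  private
    shift : ∀ k n p → k + (n + p) ≡ n + k + p
    shift k n p = trans (sym (+-assoc k n p)) (cong (_+ p) (+-comm k n))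

  module _ {Q : List X} {p : ℕ} where

    Placed-here : ∀ {i m} → Placed Q p (i ∷ m) → fetch Q p ≡ just i
    Placed-here pl = fetch-placed pl 0 refl

    Placed-tail : ∀ {i m} → Placed Q p (i ∷ m) → Placed Q (suc p) m
    Placed-tail pl = placed λ k eq → trans (cong (fetch Q) (+-suc k p)) (fetch-placed pl (suc k) eq)

    Placed-++ˡ : ∀ m₁ m₂ → Placed Q p (m₁ ++ m₂) → Placed Q p m₁
    Placed-++ˡ m₁ m₂ pl = placed λ k eq → fetch-placed pl k (fetch-++ˡ m₁ m₂ eq)

    Placed-++ʳ : ∀ m₁ m₂ → Placed Q p (m₁ ++ m₂) → Placed Q (length m₁ + p) m₂
    Placed-++ʳ m₁ m₂ pl = placed λ k eq →
      trans (cong (fetch Q) (shift k (length m₁) p)) (fetch-placed pl (length m₁ + k) (trans (fetch-++ʳ m₁ m₂ k) eq))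

    Placed-drop : ∀ n m → Placed Q p m → Placed Q (n + p) (drop n m)
    Placed-drop n m pl = placed λ k eq →
      trans (cong (fetch Q) (shift k n p)) (fetch-placed pl (n + k) (trans (sym (fetch-drop n m k)) eq))

    Placed-take : ∀ n m → Placed Q p m → Placed Q p (take n m)
    Placed-take n m pl = placed λ k eq → fetch-placed pl k (fetch-take n m eq)

  Placed-self : ∀ m → Placed m 0 m
  Placed-self m = placed λ k eq → trans (cong (fetch m) (+-identityʳ k)) eq

  Placed-inˡ : ∀ xs ys {q m} → Placed xs q m → Placed (xs ++ ys) q m
  Placed-inˡ xs ys pl = placed λ k eq → fetch-++ˡ xs ys (fetch-placed pl k eq)

  Placed-inʳ : ∀ xs ys {q m} → Placed ys q m → Placed (xs ++ ys) (length xs + q) m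
  Placed-inʳ xs ys {q} pl = placed λ k eq →
    trans (cong (fetch (xs ++ ys)) (trans (shift k (length xs) q) (+-assoc (length xs) k q)))
      (trans (fetch-++ʳ xs ys (k + q)) (fetch-placed pl k eq))

jump-free : {O : OpSet} → Instr O → Set
jump-free (jz _) = ⊥
jump-free _      = ⊤

JumpFree : {O : OpSet} → List (Instr O) → Set
JumpFree []      = ⊤
JumpFree (i ∷ m) = jump-free i × JumpFree m

run-suc : ∀ O P N inp t c → run O P N inp (suc t) c ≡ step O P N inp (run O P N inp t c)
run-suc O P N inp zero    c = refl
run-suc O P N inp (suc t) c = run-suc O P N inp t (step O P N inp c)

module _ {O : OpSet} (P : Program O) (N : ℕ) (inp : ℕ → ℕ) where

  step-fetch : ∀ c {i} → fetch P (pc c) ≡ just i → step O P N inp c ≡ exec O N inp i c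
  step-fetch c eq with fetch P (pc c)
  step-fetch c refl | just _ = refl

  step-halted : ∀ c → Halted P c → step O P N inp c ≡ c
  step-halted c halted with fetch P (pc c)
  step-halted c refl | nothing = refl

module Execution {O : OpSet} (Q : Program O) (N : ℕ) (inp : ℕ → ℕ) (bound : ℕ) where

  InBound : Config → Set
  InBound c = A c ≤ bound × B c ≤ bound

  data Steps : Config → ℕ → Config → Set where
    done : ∀ {c} → InBound c → Steps c 0 c
    next : ∀ {c k d i} → InBound c → fetch Q (pc c) ≡ just i → Steps (exec O N inp i c) k d →
           Steps c (suc k) d

  Steps-trans : ∀ {c k d k′ e} → Steps c k d → Steps d k′ e → Steps c (k + k′) e
  Steps-trans (done _)            rest = rest
  Steps-trans (next bnd eq steps) rest = next bnd eq (Steps-trans steps rest)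

  Steps-InBound : ∀ {c k d} → Steps c k d → InBound d
  Steps-InBound (done bnd)       = bnd
  Steps-InBound (next _ _ steps) = Steps-InBound steps

  Steps-run : ∀ {c k d} → Steps c k d →
    run O Q N inp k c ≡ d × (∀ s → s ≤ k → InBound (run O Q N inp s c))
  Steps-run (done bnd) = refl , λ { zero _ → bnd }
  Steps-run {c} (next {k = k} {d} bnd eq steps) =
    subst (λ c′ → run O Q N inp k c′ ≡ d) stepped (proj₁ (Steps-run steps)) ,
    λ { zero _ → bnd
      ; (suc s) (s≤s s≤k) → subst (λ c′ → InBound (run O Q N inp s c′)) stepped (proj₂ (Steps-run steps) s s≤k) }
    where stepped = sym (step-fetch Q N inp c eq)

  Steps⇒RunsTo : ∀ {c k d T bound′} → Steps c k d → k ≤ T → bound ≤ bound′ → Halted Q d →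
                 RunsTo O Q N inp c T bound′ d
  Steps⇒RunsTo {c} {k} steps k≤T bound≤ halted =
    k , k≤T , subst (Halted Q) (sym run≡d) halted , run≡d ,
    λ s s≤k → ≤-trans (proj₁ (in-bound s s≤k)) bound≤ , ≤-trans (proj₂ (in-bound s s≤k)) bound≤
    where
    run≡d = proj₁ (Steps-run steps)
    in-bound = proj₂ (Steps-run steps)

  run-straight : List (Instr O) → Config → Config
  run-straight []      c = c
  run-straight (i ∷ m) c = run-straight m (exec O N inp i c)

  InBoundAlong : List (Instr O) → Config → Set
  InBoundAlong []      c = InBound c
  InBoundAlong (i ∷ m) c = InBound c × InBoundAlong m (exec O N inp i c)

  pc-jump-free : ∀ i c → jump-free i → pc (exec O N inp i c) ≡ suc (pc c)
  pc-jump-free (setA _)  c _ = refl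
  pc-jump-free movB      c _ = refl
  pc-jump-free store     c _ = refl
  pc-jump-free load      c _ = refl
  pc-jump-free readN     c _ = refl
  pc-jump-free readI     c _ = refl
  pc-jump-free output    c _ = refl
  pc-jump-free (apply _) c _ = refl

  straight-line : ∀ m c → Placed Q (pc c) m → JumpFree m → InBoundAlong m c →
                  Steps c (length m) (run-straight m c)
  straight-line []      c _  _                bnd           = done bnd
  straight-line (i ∷ m) c pl (free , free-m) (bnd , bnd-m) =
    next bnd (Placed-here pl)
      (straight-line m _ (subst (λ p → Placed Q p m) (sym (pc-jump-free i c free)) (Placed-tail pl))
        free-m bnd-m)

  jump-taken : ∀ {p a b r o ℓ} → a ≡ 0 → fetch Q p ≡ just (jz ℓ) → InBound (cfg p a b r o) →
               Steps (cfg p a b r o) 1 (cfg ℓ a b r o)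
  jump-taken refl eq bnd = next bnd eq (done bnd)

  jump-not-taken : ∀ {p a b r o ℓ a′} → a ≡ suc a′ → fetch Q p ≡ just (jz ℓ) → InBound (cfg p a b r o) →
                   Steps (cfg p a b r o) 1 (cfg (suc p) a b r o)
  jump-not-taken refl eq bnd = next bnd eq (done bnd)

-- Adding two inputs needs addition

¬all-below-length∈ : (ns : List ℕ) → ¬ (∀ (i : Fin (suc (length ns))) → toℕ i ∈ ns)
¬all-below-length∈ ns all∈ with pigeonhole ≤-refl (λ i → index (all∈ i))
... | i , j , i<j , same-index =
  <-irrefl (index-injective (setoid ℕ) (all∈ i) (all∈ j) same-index) i<j

fresh : (ns : List ℕ) → ∃[ v ] v ≤ length ns × v ∉ ns
fresh ns with any? (λ (i : Fin (suc (length ns))) → ¬? (toℕ i ∈? ns))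
... | yes (i , i∉ns) = toℕ i , s≤s⁻¹ (toℕ<n i) , i∉ns
... | no ∄ = ⊥-elim (¬all-below-length∈ ns (λ i → decidable-stable (toℕ i ∈? ns) (λ i∉ns → ∄ (i , i∉ns))))

Covers : List (ℕ → ℕ) → ℕ → ℕ → ℕ → Set
Covers L x y v = Any (λ G → v ≡ G x ⊎ v ≡ G y) L

shifts : List (ℕ → ℕ) → ℕ → List ℕ
shifts L y = map (λ G → G y ∸ y) L

shifts-below : List (ℕ → ℕ) → ℕ → List ℕ
shifts-below L zero    = []
shifts-below L (suc n) = shifts L n ++ shifts-below L n

length-shifts-below : ∀ L n → length (shifts-below L n) ≡ n * length L
length-shifts-below L zero    = refl
length-shifts-below L (suc n) =
  trans (length-++ (shifts L n)) (cong₂ _+_ (length-map _ L) (length-shifts-below L n))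

shifts⊆shifts-below : ∀ L {n y} → y < n → shifts L y ⊆ shifts-below L n
shifts⊆shifts-below L {suc n} {y} y<1+n with m≤n⇒m<n∨m≡n (s≤s⁻¹ y<1+n)
... | inj₁ y<n  = xs⊆ys++xs _ (shifts L n) ∘ shifts⊆shifts-below L y<n
... | inj₂ refl = xs⊆xs++ys (shifts L n) _

-- x avoids every shift G y ∸ y with y ≤ C, then y ≤ C avoids every shift G x ∸ x.
uncovered-sum : ∀ (L : List (ℕ → ℕ)) {C} → length L ≡ C →
  ∃₂ λ x y → x ≤ suc C * C + C × y ≤ suc C * C + C × ¬ Covers L x y (x + y)
uncovered-sum L refl =
  x , y , ≤-trans x≤ (m≤m+n _ C) , ≤-trans y≤ (m≤n+m C _) ,
  [ y∉shifts , x∉shifts ]′ ∘ Any-⊎⁻ ∘ Any.map (λ {G} → solve-shift G)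
  where
  C = length L
  x = proj₁ (fresh (shifts-below L (suc C)))
  x≤ : x ≤ suc C * C
  x≤ = subst (x ≤_) (length-shifts-below L (suc C)) (proj₁ (proj₂ (fresh (shifts-below L (suc C)))))
  x∉ = proj₂ (proj₂ (fresh (shifts-below L (suc C))))
  y = proj₁ (fresh (shifts L x))
  y≤ : y ≤ C
  y≤ = subst (y ≤_) (length-map _ L) (proj₁ (proj₂ (fresh (shifts L x))))
  y∉ = proj₂ (proj₂ (fresh (shifts L x)))
  solve-shift : ∀ G → x + y ≡ G x ⊎ x + y ≡ G y → y ≡ G x ∸ x ⊎ x ≡ G y ∸ y
  solve-shift G (inj₁ e) = inj₁ (trans (sym (m+n∸m≡n x y)) (cong (_∸ x) e))
  solve-shift G (inj₂ e) = inj₂ (trans (sym (m+n∸n≡m x y)) (cong (_∸ y) e))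
  y∉shifts : Any (λ G → y ≡ G x ∸ x) L → ⊥
  y∉shifts = y∉ ∘ map⁺
  x∉shifts : Any (λ G → x ≡ G y ∸ y) L → ⊥
  x∉shifts = x∉ ∘ shifts⊆shifts-below L (s≤s y≤) ∘ map⁺

covers-∘ : ∀ (h : ℕ → ℕ) {L x y a} → Covers L x y a → Covers (map (λ G z → h (G z)) L) x y (h a)
covers-∘ h = map⁺ ∘ Any.map (Sum.map (cong h) (cong h))

constant-of : Instr SuccPred → List ℕ
constant-of (setA j) = j ∷ []
constant-of _        = []

constants : Program SuccPred → List ℕ
constants []      = []
constants (i ∷ P) = constant-of i ++ constants P

fetch-setA⇒∈constants : ∀ P n {j} → fetch P n ≡ just (setA j) → j ∈ constants P
fetch-setA⇒∈constants (setA j ∷ P) zero    refl = here refl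
fetch-setA⇒∈constants (i ∷ P)      (suc n) eq   =
  xs⊆ys++xs (constants P) (constant-of i) (fetch-setA⇒∈constants P n eq)

extend-size : Program SuccPred → ℕ → ℕ
extend-size P n = 3 + length (constants P) + (n + (n + (n + n)))

family-size : Program SuccPred → ℕ → ℕ
family-size P zero    = 3 + length (constants P)
family-size P (suc t) = extend-size P (family-size P t)

module ValueFamily (P : Program SuccPred) (N : ℕ) (R0 : ℕ → ℕ) where

  base : List (ℕ → ℕ)
  base = (λ _ → 0) ∷ (λ z → z) ∷ (λ _ → N) ∷ map (λ j _ → j) (constants P)

  extend : List (ℕ → ℕ) → List (ℕ → ℕ)
  extend L = base ++ (L ++ (map (λ G z → suc (G z)) L ++ (map (λ G z → G z ∸ 1) L
               ++ map (λ G z → R0 (G z)) L)))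

  family : ℕ → List (ℕ → ℕ)
  family zero    = base
  family (suc t) = extend (family t)

  length-base : length base ≡ 3 + length (constants P)
  length-base = cong (3 +_) (length-map _ (constants P))

  length-extend : ∀ L → length (extend L) ≡ extend-size P (length L)
  length-extend L =
    trans (length-++ base) (cong₂ _+_ length-base
      (trans (length-++ L) (cong (length L +_)
      (trans (length-++ (map _ L)) (cong₂ _+_ (length-map _ L)
      (trans (length-++ (map _ L)) (cong₂ _+_ (length-map _ L) (length-map _ L))))))))

  length-family : ∀ t → length (family t) ≡ family-size P t
  length-family zero    = length-base
  length-family (suc t) = trans (length-extend (family t)) (cong (extend-size P) (length-family t))

  ⊆-extend : ∀ L → L ⊆ extend L
  ⊆-extend L = xs⊆ys++xs _ base ∘ xs⊆xs++ys L _

  family-mono : ∀ {t u} → t ≤ u → family t ⊆ family u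
  family-mono {u = zero} z≤n = λ v∈ → v∈
  family-mono {t} {suc u} t≤1+u with m≤n⇒m<n∨m≡n t≤1+u
  ... | inj₁ t<1+u = ⊆-extend (family u) ∘ family-mono (s≤s⁻¹ t<1+u)
  ... | inj₂ refl  = λ v∈ → v∈

  module Covering (x y : ℕ) where

    input : ℕ → ℕ
    input = readVec {2} (x ∷ y ∷ [])

    Covered : List (ℕ → ℕ) → Config → Set
    Covered L c = Covers L x y (A c) × Covers L x y (B c)
      × (∀ i → R c i ≡ R0 i ⊎ Covers L x y (R c i)) × All (Covers L x y) (outs c)

    Covered-mono : ∀ {L L'} → L ⊆ L' → ∀ c → Covered L c → Covered L' c
    Covered-mono L⊆L' c (a , b , r , o) =
      Any-resp-⊆ L⊆L' a , Any-resp-⊆ L⊆L' b , Sum.map₂ (Any-resp-⊆ L⊆L') ∘ r , All.map (Any-resp-⊆ L⊆L') o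

    module _ (L : List (ℕ → ℕ)) where

      private
        Ls = map (λ G z → suc (G z)) L
        Lp = map (λ G z → G z ∸ 1) L
        Lr = map (λ G z → R0 (G z)) L

        base⊆ : base ⊆ extend L
        base⊆ = xs⊆xs++ys base _
        succ⊆ : Ls ⊆ extend L
        succ⊆ = xs⊆ys++xs _ base ∘ xs⊆ys++xs _ L ∘ xs⊆xs++ys Ls _
        pred⊆ : Lp ⊆ extend L
        pred⊆ = xs⊆ys++xs _ base ∘ xs⊆ys++xs _ L ∘ xs⊆ys++xs _ Ls ∘ xs⊆xs++ys Lp Lr
        R0⊆ : Lr ⊆ extend L
        R0⊆ = xs⊆ys++xs _ base ∘ xs⊆ys++xs _ L ∘ xs⊆ys++xs _ Ls ∘ xs⊆ys++xs Lr Lp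

        covers-base : ∀ {v} → Any (λ G → v ≡ G x ⊎ v ≡ G y) base → Covers (extend L) x y v
        covers-base = Any-resp-⊆ base⊆

        weaken : ∀ c → Covered L c → Covered (extend L) c
        weaken = Covered-mono (⊆-extend L)

        covers-input : ∀ a → Covers (extend L) x y (input a)
        covers-input zero          = covers-base (there (here (inj₁ refl)))
        covers-input (suc zero)    = covers-base (there (here (inj₂ refl)))
        covers-input (suc (suc a)) = covers-base (here (inj₁ refl))

      exec-covered : ∀ i c → fetch P (pc c) ≡ just i → Covered L c →
                     Covered (extend L) (exec SuccPred N input i c)
      exec-covered (setA j) c@(cfg p a b r o) eq cov =
        covers-base (there (there (there (map⁺ (Any.map inj₁ (fetch-setA⇒∈constants P p eq)))))) ,
        proj₂ (weaken c cov)
      exec-covered movB c _ cov with weaken c cov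
      ... | wa , _ , wr , wo = wa , wa , wr , wo
      exec-covered store c@(cfg p a b r o) _ cov with weaken c cov
      ... | wa , wb , wr , wo = wa , wb , stored , wo
        where
        stored : ∀ i → (if i ≡ᵇ a then b else r i) ≡ R0 i ⊎ Covers (extend L) x y (if i ≡ᵇ a then b else r i)
        stored i with i ≡ᵇ a
        ... | true  = inj₂ wb
        ... | false = wr i
      exec-covered load c@(cfg p a b r o) _ cov@(ca , _) with weaken c cov
      ... | _ , wb , wr , wo = loaded , wb , wr , wo
        where
        loaded : Covers (extend L) x y (r a)
        loaded with wr a
        ... | inj₁ ra≡R0a = subst (Covers (extend L) x y) (sym ra≡R0a) (Any-resp-⊆ R0⊆ (covers-∘ R0 ca))
        ... | inj₂ ra = ra
      exec-covered (jz ℓ) c@(cfg p zero b r o)    _ cov = weaken c cov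
      exec-covered (jz ℓ) c@(cfg p (suc a) b r o) _ cov = weaken c cov
      exec-covered readN c _ cov = covers-base (there (there (here (inj₁ refl)))) , proj₂ (weaken c cov)
      exec-covered readI c _ cov = covers-input (A c) , proj₂ (weaken c cov)
      exec-covered output c _ cov with weaken c cov
      ... | wa , wb , wr , wo = wa , wb , wr , All.++⁺ wo (wa ∷ [])
      exec-covered (apply succ) c _ cov@(ca , _) = Any-resp-⊆ succ⊆ (covers-∘ suc ca) , proj₂ (weaken c cov)
      exec-covered (apply pred) c _ cov@(ca , _) =
        Any-resp-⊆ pred⊆ (covers-∘ (_∸ 1) ca) , proj₂ (weaken c cov)

      step-covered : ∀ c → Covered L c → Covered (extend L) (step SuccPred P N input c)
      step-covered c cov with fetch P (pc c) in eq
      ... | nothing = weaken c cov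
      ... | just i  = exec-covered i c eq cov

    run-covered : ∀ t c → Covered base c → Covered (family t) (run SuccPred P N input t c)
    run-covered zero    c cov = cov
    run-covered (suc t) c cov rewrite run-suc SuccPred P N input t c =
      step-covered (family t) (run SuccPred P N input t c) (run-covered t c cov)

    outputs-covered : ∀ {T bound τ} → RunsTo SuccPred P N input (cfg 0 0 0 R0 []) T bound τ →
                      All (Covers (family T) x y) (outs τ)
    outputs-covered (t , t≤T , _ , run≡τ , _) =
      All.map (Any-resp-⊆ (family-mono t≤T))
        (subst (All (Covers (family t) x y) ∘ outs) run≡τ (proj₂ (proj₂ (proj₂ (run-covered t _ start)))))
      where
      start : Covered base (cfg 0 0 0 R0 [])
      start = here (inj₁ refl) , here (inj₁ refl) , (λ _ → inj₁ refl) , []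

sum-problem : Problem 2
sum-problem N I (x ∷ y ∷ []) = x + y ∷ []

zeros-bounded : ∀ c N n → Bounded c N (Vec.replicate n 0)
zeros-bounded c N zero    = VecAll.[]
zeros-bounded c N (suc n) = z≤n VecAll.∷ zeros-bounded c N n

sum∉CONST-LIN-succ : ¬ CONST-LIN-succ 1 2 sum-problem
sum∉CONST-LIN-succ (P₁ , P₂ , K , solves) = contradiction
  where
  C = family-size P₂ K
  N = suc C * C + C
  preprocessed = solves N (Vec.replicate N 0) (zeros-bounded 1 N N)
  open ValueFamily P₂ N (R (proj₁ preprocessed))
  ≤1*N : ∀ {v} → v ≤ N → v ≤ 1 * N
  ≤1*N v≤N = ≤-trans v≤N (m≤m+n N 0)
  contradiction : ⊥
  contradiction with uncovered-sum (family K) (length-family K)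
  ... | x , y , x≤N , y≤N , ¬covered
    with proj₂ (proj₂ preprocessed) (x ∷ y ∷ []) (≤1*N x≤N VecAll.∷ ≤1*N y≤N VecAll.∷ VecAll.[])
  ... | τ , runs , outs≡ =
    ¬covered (All.head (subst (All (Covers (family K) x y)) outs≡ (Covering.outputs-covered x y runs)))

sum∈CONST-LIN : CONST-LIN 1 2 sum-problem
sum∈CONST-LIN = [] , add-inputs , 7 , λ N I _ → initConfig , no-preprocessing N I , answer N I
  where
  add-inputs : Program Plus
  add-inputs = setA 1 ∷ readI ∷ movB ∷ setA 0 ∷ readI ∷ apply plus ∷ output ∷ []
  no-preprocessing : ∀ N (I : Vec ℕ N) →
    RunsTo Plus [] N (readVec I) initConfig (7 * suc N) (7 * suc N) initConfig
  no-preprocessing N I = 0 , z≤n , refl , refl , λ { zero _ → z≤n , z≤n }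
  answer : ∀ N (I : Vec ℕ N) (X : Vec ℕ 2) → Bounded 1 N X → Σ Config λ τ →
    RunsTo Plus add-inputs N (readVec X) (phase2 initConfig) 7 (7 * suc N) τ × outs τ ≡ sum-problem N I X
  answer N I (x ∷ y ∷ []) (x≤N VecAll.∷ y≤N VecAll.∷ VecAll.[]) =
    _ , Steps⇒RunsTo (straight-line add-inputs (phase2 initConfig) (Placed-self add-inputs) _
          ((z≤n , z≤n) , (1≤ , z≤n) , (y≤ , z≤n) , (y≤ , y≤) , (z≤n , y≤) , (x≤ , y≤) , (x+y≤ , y≤) , (x+y≤ , y≤)))
          ≤-refl ≤-refl refl ,
    refl
    where
    open Execution add-inputs N (readVec (x ∷ y ∷ [])) (7 * suc N)
    small : ∀ {v} → v ≤ 1 * N + 1 * N → v ≤ 7 * suc N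
    small v≤ = ≤-trans v≤ (+-mono-≤ 1*N≤1+N (≤-trans 1*N≤1+N (m≤m+n (suc N) _)))
      where 1*N≤1+N = ≤-trans (≤-reflexive (*-identityˡ N)) (n≤1+n N)
    1≤ : 1 ≤ 7 * suc N
    1≤ = ≤-trans (s≤s z≤n) (m≤m+n (suc N) _)
    x≤ : x ≤ 7 * suc N
    x≤ = small (≤-trans x≤N (m≤m+n _ _))
    y≤ : y ≤ 7 * suc N
    y≤ = small (≤-trans y≤N (m≤n+m _ (1 * N)))
    x+y≤ : x + y ≤ 7 * suc N
    x+y≤ = small (+-mono-≤ x≤N y≤N)

-- Simulating successor and predecessor with addition

-- Addition clobbers B: the simulated B is reloaded from its copy R′[1], with A parked in R′[0].
restore-B : List (Instr Plus)
restore-B = movB ∷ setA 0 ∷ store ∷ setA 1 ∷ load ∷ movB ∷ setA 0 ∷ load ∷ []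

-- tr translates SuccPred jump targets into positions of the compiled program.
compile-instr : (ℕ → ℕ) → Instr SuccPred → List (Instr Plus)
compile-instr tr (setA j)     = setA j ∷ []
compile-instr tr movB         = movB ∷ setA 1 ∷ store ∷ setA 1 ∷ load ∷ []
compile-instr tr store        = movB ∷ setA 0 ∷ store ∷ setA 5 ∷ apply plus ∷ movB ∷ setA 2 ∷ store ∷
                                setA 1 ∷ load ∷ movB ∷ setA 2 ∷ load ∷ store ∷ setA 0 ∷ load ∷ []
compile-instr tr load         = movB ∷ setA 5 ∷ apply plus ∷ load ∷ restore-B
compile-instr tr (jz ℓ)       = jz (tr ℓ) ∷ []
compile-instr tr readN        = readN ∷ []
compile-instr tr readI        = readI ∷ []
compile-instr tr output       = output ∷ []
compile-instr tr (apply succ) = movB ∷ setA 1 ∷ apply plus ∷ restore-B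
compile-instr tr (apply pred) = movB ∷ setA 3 ∷ load ∷ apply plus ∷ load ∷ restore-B

block-length : Instr SuccPred → ℕ
block-length i = length (compile-instr (λ _ → 0) i)

length-compile-instr : ∀ tr i → length (compile-instr tr i) ≡ block-length i
length-compile-instr tr (setA _)     = refl
length-compile-instr tr movB         = refl
length-compile-instr tr store        = refl
length-compile-instr tr load         = refl
length-compile-instr tr (jz _)       = refl
length-compile-instr tr readN        = refl
length-compile-instr tr readI        = refl
length-compile-instr tr output       = refl
length-compile-instr tr (apply succ) = refl
length-compile-instr tr (apply pred) = refl

block-length≤16 : ∀ i → block-length i ≤ 16
block-length≤16 (setA _)     = ≤ᵇ⇒≤ _ 16 _
block-length≤16 movB         = ≤ᵇ⇒≤ _ 16 _
block-length≤16 store        = ≤ᵇ⇒≤ _ 16 _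
block-length≤16 load         = ≤ᵇ⇒≤ _ 16 _
block-length≤16 (jz _)       = ≤ᵇ⇒≤ _ 16 _
block-length≤16 readN        = ≤ᵇ⇒≤ _ 16 _
block-length≤16 readI        = ≤ᵇ⇒≤ _ 16 _
block-length≤16 output       = ≤ᵇ⇒≤ _ 16 _
block-length≤16 (apply succ) = ≤ᵇ⇒≤ _ 16 _
block-length≤16 (apply pred) = ≤ᵇ⇒≤ _ 16 _

compile : (ℕ → ℕ) → Program SuccPred → Program Plus
compile tr []      = []
compile tr (i ∷ P) = compile-instr tr i ++ compile tr P

block-start : Program SuccPred → ℕ → ℕ
block-start P       zero    = 0
block-start []      (suc ℓ) = 0
block-start (i ∷ P) (suc ℓ) = block-length i + block-start P ℓ

compile-instr-placed : ∀ tr P p {i} → fetch P p ≡ just i →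
                       Placed (compile tr P) (block-start P p) (compile-instr tr i)
compile-instr-placed tr (j ∷ P) zero    refl = Placed-inˡ (compile-instr tr j) (compile tr P) (Placed-self _)
compile-instr-placed tr (j ∷ P) (suc p) eq   =
  subst (λ q → Placed (compile tr (j ∷ P)) (q + block-start P p) _) (length-compile-instr tr j)
    (Placed-inʳ (compile-instr tr j) (compile tr P) (compile-instr-placed tr P p eq))

block-start-halted : ∀ tr P p → fetch P p ≡ nothing → block-start P p ≡ length (compile tr P)
block-start-halted tr []      zero    _      = refl
block-start-halted tr []      (suc p) _      = refl
block-start-halted tr (i ∷ P) (suc p) halted =
  trans (cong₂ _+_ (sym (length-compile-instr tr i)) (block-start-halted tr P p halted))
    (sym (length-++ (compile-instr tr i)))

block-start-suc : ∀ P p {i} → fetch P p ≡ just i → block-start P (suc p) ≡ block-length i + block-start P p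
block-start-suc (j ∷ P) zero    refl = refl
block-start-suc (j ∷ P) (suc p) {i} eq =
  trans (cong (block-length j +_) (block-start-suc P p eq)) (x∙yz≈y∙xz (block-length j) (block-length i) _)

-- Memory layout of the simulating Plus machine: R′[1] keeps a copy of B (R′[0] and R′[2] are
-- scratch), R′[3] = 6 + M is the base of the predecessor table R′[6 + M + v] = v ∸ 1, and the
-- simulated register R[i] lives in R′[5 + i].
module Simulation (M : ℕ) where

  Represents : ℕ → (ℕ → ℕ) → (ℕ → ℕ) → Set
  Represents b r′ r = r′ 1 ≡ b × r′ 3 ≡ 6 + M × (∀ i → i ≤ M → r′ (5 + i) ≡ r i)
                      × (∀ v → v ≤ M → r′ (6 + M + v) ≡ v ∸ 1)

  record Simulates (tr : ℕ → ℕ) (c c′ : Config) : Set where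
    constructor simulates
    field
      pc≡    : pc c′ ≡ tr (pc c)
      A≡     : A c′ ≡ A c
      B≡     : B c′ ≡ B c
      outs≡  : outs c′ ≡ outs c
      memory : Represents (B c) (R c′) (R c)

  Small : Config → Set
  Small c = A c ≤ M × B c ≤ M

  module Blocks (Q : Program Plus) (N : ℕ) (inp : ℕ → ℕ) (Bd : ℕ) (6+M+M≤Bd : 6 + M + M ≤ Bd)
                (tr : ℕ → ℕ) where
    open Execution Q N inp Bd public

    M≤ : ∀ {v} → v ≤ M → v ≤ Bd
    M≤ v≤M = ≤-trans v≤M (≤-trans (m≤n+m M (6 + M)) 6+M+M≤Bd)
    6≤ : ∀ {k} → k ≤ 6 → k ≤ Bd
    6≤ k≤6 = ≤-trans k≤6 (≤-trans (m≤m+n 6 (M + M)) 6+M+M≤Bd)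
    table≤ : ∀ {v} → v ≤ M → 6 + M + v ≤ Bd
    table≤ v≤M = ≤-trans (+-monoʳ-≤ (6 + M) v≤M) 6+M+M≤Bd
    cell≤ : ∀ {v} → v ≤ M → 5 + v ≤ Bd
    cell≤ {v} v≤M = ≤-trans (n≤1+n (5 + v)) (≤-trans (+-monoʳ-≤ 6 (≤-trans v≤M (m≤m+n M M))) 6+M+M≤Bd)
    1≤ : 1 ≤ Bd
    1≤ = 6≤ (≤ᵇ⇒≤ 1 6 _)
    2≤ : 2 ≤ Bd
    2≤ = 6≤ (≤ᵇ⇒≤ 2 6 _)
    3≤ : 3 ≤ Bd
    3≤ = 6≤ (≤ᵇ⇒≤ 3 6 _)
    5≤ : 5 ≤ Bd
    5≤ = 6≤ (≤ᵇ⇒≤ 5 6 _)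

    exec-succ : Instr SuccPred → Config → Config
    exec-succ = exec SuccPred N inp

    BlockCorrect : Instr SuccPred → Set
    BlockCorrect i = ∀ p a b r o r′ → Represents b r′ r → Placed Q (tr p) (compile-instr tr i) →
      Small (cfg p a b r o) → Small (exec-succ i (cfg p a b r o)) → tr (suc p) ≡ block-length i + tr p →
      Σ Config λ c′ → Steps (cfg (tr p) a b r′ o) (block-length i) c′ × Simulates tr (exec-succ i (cfg p a b r o)) c′

    block-setA : ∀ j → BlockCorrect (setA j)
    block-setA j p a b r o r′ rep pl (a≤ , b≤) (j≤ , _) tr-suc =
      _ , straight-line _ _ pl _ ((M≤ a≤ , M≤ b≤) , (M≤ j≤ , M≤ b≤)) , simulates (sym tr-suc) refl refl refl rep

    block-readN : BlockCorrect readN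
    block-readN p a b r o r′ rep pl (a≤ , b≤) (N≤ , _) tr-suc =
      _ , straight-line _ _ pl _ ((M≤ a≤ , M≤ b≤) , (M≤ N≤ , M≤ b≤)) , simulates (sym tr-suc) refl refl refl rep

    block-readI : BlockCorrect readI
    block-readI p a b r o r′ rep pl (a≤ , b≤) (I≤ , _) tr-suc =
      _ , straight-line _ _ pl _ ((M≤ a≤ , M≤ b≤) , (M≤ I≤ , M≤ b≤)) , simulates (sym tr-suc) refl refl refl rep

    block-output : BlockCorrect output
    block-output p a b r o r′ rep pl (a≤ , b≤) _ tr-suc =
      _ , straight-line _ _ pl _ ((M≤ a≤ , M≤ b≤) , (M≤ a≤ , M≤ b≤)) , simulates (sym tr-suc) refl refl refl rep

    block-movB : BlockCorrect movB
    block-movB p a b r o r′ (_ , base , cells , table) pl (a≤ , b≤) _ tr-suc =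
      _ , straight-line _ _ pl _
        ((M≤ a≤ , M≤ b≤) , (M≤ a≤ , M≤ a≤) , (1≤ , M≤ a≤) , (1≤ , M≤ a≤) , (1≤ , M≤ a≤) , (M≤ a≤ , M≤ a≤)) ,
      simulates (sym tr-suc) refl refl refl (refl , base , cells , table)

    block-store : BlockCorrect store
    block-store p a b r o r′ (saved , base , cells , table) pl (a≤ , b≤) _ tr-suc =
      _ , straight-line _ _ pl _
        ((A≤ , M≤ b≤) , (A≤ , A≤) , (z≤n , A≤) , (z≤n , A≤) , (5≤ , A≤) , (cell≤ a≤ , A≤) ,
         (cell≤ a≤ , cell≤ a≤) , (2≤ , cell≤ a≤) , (2≤ , cell≤ a≤) , (1≤ , cell≤ a≤) , (B≤ , cell≤ a≤) ,
         (B≤ , B≤) , (2≤ , B≤) , (cell≤ a≤ , B≤) , (cell≤ a≤ , B≤) , (z≤n , B≤) , (A≤ , B≤)) ,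
      simulates (sym tr-suc) refl saved refl (saved , base , cells′ , table′)
      where
      A≤ = M≤ a≤
      B≤ : r′ 1 ≤ Bd
      B≤ = subst (_≤ Bd) (sym saved) (M≤ b≤)
      cells′ : ∀ i → i ≤ M → (if i ≡ᵇ a then r′ 1 else r′ (5 + i)) ≡ (if i ≡ᵇ a then b else r i)
      cells′ i i≤M with i ≡ᵇ a
      ... | true  = saved
      ... | false = cells i i≤M
      table′ : ∀ v → v ≤ M → (if suc (M + v) ≡ᵇ a then r′ 1 else r′ (6 + M + v)) ≡ v ∸ 1
      table′ v v≤M = trans (if-≡ᵇ-≢ (≢-sym (<⇒≢ (s≤s (≤-trans a≤ (m≤m+n M v)))))) (table v v≤M)

    block-load : BlockCorrect load
    block-load p a b r o r′ (saved , base , cells , table) pl (a≤ , b≤) (ra≤ , _) tr-suc =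
      _ , straight-line _ _ pl _
        ((A≤ , M≤ b≤) , (A≤ , A≤) , (5≤ , A≤) , (cell≤ a≤ , A≤) , (V≤ , A≤) ,
         (V≤ , V≤) , (z≤n , V≤) , (z≤n , V≤) , (1≤ , V≤) , (B≤ , V≤) , (B≤ , B≤) , (z≤n , B≤) , (V≤ , B≤)) ,
      simulates (sym tr-suc) (cells a a≤) saved refl (saved , base , cells , table)
      where
      A≤ = M≤ a≤
      B≤ : r′ 1 ≤ Bd
      B≤ = subst (_≤ Bd) (sym saved) (M≤ b≤)
      V≤ : r′ (5 + a) ≤ Bd
      V≤ = subst (_≤ Bd) (sym (cells a a≤)) (M≤ ra≤)

    block-succ : BlockCorrect (apply succ)
    block-succ p a b r o r′ (saved , base , cells , table) pl (a≤ , b≤) (a+1≤ , _) tr-suc =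
      _ , straight-line _ _ pl _
        ((A≤ , M≤ b≤) , (A≤ , A≤) , (1≤ , A≤) , (V≤ , A≤) ,
         (V≤ , V≤) , (z≤n , V≤) , (z≤n , V≤) , (1≤ , V≤) , (B≤ , V≤) , (B≤ , B≤) , (z≤n , B≤) , (V≤ , B≤)) ,
      simulates (sym tr-suc) refl saved refl (saved , base , cells , table)
      where
      A≤ = M≤ a≤
      B≤ : r′ 1 ≤ Bd
      B≤ = subst (_≤ Bd) (sym saved) (M≤ b≤)
      V≤ = M≤ a+1≤

    block-pred : BlockCorrect (apply pred)
    block-pred p a b r o r′ (saved , base , cells , table) pl (a≤ , b≤) (a-1≤ , _) tr-suc =
      _ , straight-line _ _ pl _
        ((A≤ , M≤ b≤) , (A≤ , A≤) , (3≤ , A≤) , (base≤ , A≤) , (base+a≤ , A≤) , (V≤ , A≤) ,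
         (V≤ , V≤) , (z≤n , V≤) , (z≤n , V≤) , (1≤ , V≤) , (B≤ , V≤) , (B≤ , B≤) , (z≤n , B≤) , (V≤ , B≤)) ,
      simulates (sym tr-suc) looked-up saved refl (saved , base , cells , table)
      where
      A≤ = M≤ a≤
      B≤ : r′ 1 ≤ Bd
      B≤ = subst (_≤ Bd) (sym saved) (M≤ b≤)
      base≤ : r′ 3 ≤ Bd
      base≤ = subst (_≤ Bd) (sym base) (≤-trans (m≤m+n (6 + M) 0) (table≤ z≤n))
      base+a≤ : r′ 3 + a ≤ Bd
      base+a≤ = subst (λ z → z + a ≤ Bd) (sym base) (table≤ a≤)
      looked-up : r′ (r′ 3 + a) ≡ a ∸ 1
      looked-up = trans (cong (λ z → r′ (z + a)) base) (table a a≤)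
      V≤ : r′ (r′ 3 + a) ≤ Bd
      V≤ = subst (_≤ Bd) (sym looked-up) (M≤ a-1≤)

    block-jz : ∀ ℓ p a b r o r′ → Represents b r′ r → Placed Q (tr p) (compile-instr tr (jz ℓ)) →
      Small (cfg p a b r o) → tr (suc p) ≡ 1 + tr p →
      Σ Config λ c′ → Steps (cfg (tr p) a b r′ o) 1 c′ × Simulates tr (exec-succ (jz ℓ) (cfg p a b r o)) c′
    block-jz ℓ p zero    b r o r′ rep pl (a≤ , b≤) tr-suc =
      _ , jump-taken refl (Placed-here pl) (M≤ a≤ , M≤ b≤) , simulates refl refl refl refl rep
    block-jz ℓ p (suc a) b r o r′ rep pl (a≤ , b≤) tr-suc =
      _ , jump-not-taken refl (Placed-here pl) (M≤ a≤ , M≤ b≤) , simulates (sym tr-suc) refl refl refl rep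

    module SimulateRun (P : Program SuccPred)
        (placed : ∀ p {i} → fetch P p ≡ just i → Placed Q (tr p) (compile-instr tr i))
        (tr-suc : ∀ p {i} → fetch P p ≡ just i → tr (suc p) ≡ block-length i + tr p) where

      simulate-step : ∀ i c c′ → fetch P (pc c) ≡ just i → Simulates tr c c′ → Small c → Small (exec-succ i c) →
        Σ Config λ c″ → Steps c′ (block-length i) c″ × Simulates tr (exec-succ i c) c″
      simulate-step i (cfg p a b r o) (cfg _ _ _ r′ _) eq (simulates refl refl refl refl rep) small small′
        with i
      ... | setA j     = block-setA j p a b r o r′ rep (placed p eq) small small′ (tr-suc p eq)
      ... | movB       = block-movB p a b r o r′ rep (placed p eq) small small′ (tr-suc p eq)
      ... | store      = block-store p a b r o r′ rep (placed p eq) small small′ (tr-suc p eq)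
      ... | load       = block-load p a b r o r′ rep (placed p eq) small small′ (tr-suc p eq)
      ... | jz ℓ       = block-jz ℓ p a b r o r′ rep (placed p eq) small (tr-suc p eq)
      ... | readN      = block-readN p a b r o r′ rep (placed p eq) small small′ (tr-suc p eq)
      ... | readI      = block-readI p a b r o r′ rep (placed p eq) small small′ (tr-suc p eq)
      ... | output     = block-output p a b r o r′ rep (placed p eq) small small′ (tr-suc p eq)
      ... | apply succ = block-succ p a b r o r′ rep (placed p eq) small small′ (tr-suc p eq)
      ... | apply pred = block-pred p a b r o r′ rep (placed p eq) small small′ (tr-suc p eq)

      run-succ : ℕ → Config → Config
      run-succ t c = run SuccPred P N inp t c

      SmallFor : ℕ → Config → Set
      SmallFor t c = ∀ s → s ≤ t → Small (run-succ s c)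

      Simulated : ℕ → Config → Config → Set
      Simulated t c c′ = Σ Config λ c″ → Σ ℕ λ k → k ≤ 16 * t × Steps c′ k c″ × Simulates tr (run-succ t c) c″

      SmallFor-step : ∀ t c → SmallFor (suc t) c → SmallFor t (step SuccPred P N inp c)
      SmallFor-step t c small s s≤t = small (suc s) (s≤s s≤t)

      simulate : ∀ t c c′ → Simulates tr c c′ → SmallFor t c → Simulated t c c′
      simulate zero c c′ sim small =
        c′ , 0 , z≤n , done (small≤ Simulates.A≡ proj₁ , small≤ Simulates.B≡ proj₂) , sim
        where
        small≤ : ∀ {X : Config → ℕ} → (Simulates tr c c′ → X c′ ≡ X c) → (Small c → X c ≤ M) → X c′ ≤ Bd
        small≤ {X} eq get = subst (_≤ Bd) (sym (eq sim)) (M≤ (get (small 0 z≤n)))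
      simulate (suc t) c c′ sim small = by-instruction (fetch P (pc c)) refl
        where
        later-small : ∀ {c₁} → step SuccPred P N inp c ≡ c₁ → SmallFor t c₁
        later-small stepped = subst (SmallFor t) stepped (SmallFor-step t c small)
        by-instruction : ∀ m → fetch P (pc c) ≡ m → Simulated (suc t) c c′
        by-instruction nothing eq with simulate t c c′ sim (later-small (step-halted P N inp c eq))
        ... | c″ , k , k≤ , steps , sim′ =
          c″ , k , ≤-trans k≤ (*-monoʳ-≤ 16 (n≤1+n t)) , steps ,
          subst (λ z → Simulates tr (run-succ t z) c″) (sym (step-halted P N inp c eq)) sim′
        by-instruction (just i) eq
          with simulate-step i c c′ eq sim (small 0 z≤n) (subst Small (step-fetch P N inp c eq) (small 1 (s≤s z≤n)))
        ... | c₁ , steps₁ , sim₁ with simulate t _ c₁ sim₁ (later-small (step-fetch P N inp c eq))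
        ... | c″ , k , k≤ , steps , sim′ =
          c″ , block-length i + k , ≤-trans (+-mono-≤ (block-length≤16 i) k≤) (≤-reflexive (sym (*-suc 16 t))) ,
          Steps-trans steps₁ steps , subst (λ z → Simulates tr (run-succ t z) c″) (sym (step-fetch P N inp c eq)) sim′

-- Building the predecessor table

probe : List (Instr Plus)
probe = setA 4 ∷ load ∷ movB ∷ setA 2 ∷ load ∷ apply plus ∷ load ∷ []

fill-entry : List (Instr Plus)
fill-entry = setA 2 ∷ load ∷ movB ∷ setA 1 ∷ store ∷ apply plus ∷ movB ∷ setA 2 ∷ store ∷ setA 3 ∷ load ∷
             apply plus ∷ movB ∷ setA 0 ∷ store ∷ setA 1 ∷ load ∷ movB ∷ setA 0 ∷ load ∷ store ∷ setA 0 ∷ []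

clear-saved-B : List (Instr Plus)
clear-saved-B = movB ∷ setA 1 ∷ store ∷ setA 0 ∷ []

table-loop : ℕ → List (Instr Plus)
table-loop q = probe ++ (jz (10 + q) ∷ []) ++ (setA 0 ∷ []) ++ (jz (33 + q) ∷ []) ++ fill-entry ++ (jz q ∷ [])
               ++ clear-saved-B

-- With its counter in R[2], the loop fills the table R[Tbl + v] = v ∸ 1 for v = 1, …, M + 1.
-- The exit test can only use jz: R[U + w] = 0 for w ≤ M and a sentinel R[W] = 1 sits at
-- W = U + M + 1, so the probe R[R[2] + U] becomes nonzero exactly when the counter reaches M + 1.
module TableLoop (Q : Program Plus) (N : ℕ) (inp : ℕ → ℕ) (M : ℕ) (q : ℕ)
                 (placed : Placed Q q (table-loop q)) where
  Tbl = 6 + M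
  U = 2 + (M + Tbl)
  W = 1 + (M + U)
  Bd = suc W

  open Execution Q N inp Bd

  Invariant : (ℕ → ℕ) → Set
  Invariant r = r 3 ≡ Tbl × r 4 ≡ U × r W ≡ 1 × r 2 ≤ suc M × (∀ i → i ≤ M → r (5 + i) ≡ 0)
                × (∀ v → v ≤ M → v ≤ r 2 → r (Tbl + v) ≡ v ∸ 1) × (∀ w → w ≤ M → r (w + U) ≡ 0)

  probe-placed : Placed Q q probe
  probe-placed = Placed-take 7 (table-loop q) placed
  enter-placed : fetch Q (7 + q) ≡ just (jz (10 + q))
  enter-placed = Placed-here (Placed-drop 7 (table-loop q) placed)
  zero-placed : Placed Q (8 + q) (setA 0 ∷ [])
  zero-placed = Placed-take 1 _ (Placed-drop 8 (table-loop q) placed)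
  exit-placed : fetch Q (9 + q) ≡ just (jz (33 + q))
  exit-placed = Placed-here (Placed-drop 9 (table-loop q) placed)
  fill-placed : Placed Q (10 + q) fill-entry
  fill-placed = Placed-take 22 _ (Placed-drop 10 (table-loop q) placed)
  back-placed : fetch Q (32 + q) ≡ just (jz q)
  back-placed = Placed-here (Placed-drop 32 (table-loop q) placed)
  clear-placed : Placed Q (33 + q) clear-saved-B
  clear-placed = Placed-drop 33 (table-loop q) placed

  W≤ : W ≤ Bd
  W≤ = n≤1+n W
  U≤ : U ≤ Bd
  U≤ = ≤-trans (m≤n+m U (suc M)) W≤
  Tbl≤ : Tbl ≤ Bd
  Tbl≤ = ≤-trans (≤-trans (m≤n+m Tbl M) (≤-trans (n≤1+n _) (n≤1+n _))) U≤
  1+M≤ : ∀ {v} → v ≤ suc M → v ≤ Bd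
  1+M≤ v≤ = ≤-trans v≤ (≤-trans (s≤s (≤-trans (m≤m+n M 5) (≤-reflexive (+-comm M 5)))) Tbl≤)
  6≤ : ∀ {k} → k ≤ 6 → k ≤ Bd
  6≤ k≤6 = ≤-trans k≤6 (≤-trans (m≤m+n 6 M) Tbl≤)
  1≤ : 1 ≤ Bd
  1≤ = 6≤ (≤ᵇ⇒≤ 1 6 _)
  2≤ : 2 ≤ Bd
  2≤ = 6≤ (≤ᵇ⇒≤ 2 6 _)
  3≤ : 3 ≤ Bd
  3≤ = 6≤ (≤ᵇ⇒≤ 3 6 _)
  4≤ : 4 ≤ Bd
  4≤ = 6≤ (≤ᵇ⇒≤ 4 6 _)

  Tbl+v<U : ∀ {v} → v ≤ suc M → Tbl + v < U
  Tbl+v<U v≤ =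
    s≤s (≤-trans (+-monoʳ-≤ Tbl v≤) (≤-trans (≤-reflexive (+-suc Tbl M)) (s≤s (≤-reflexive (+-comm Tbl M)))))
  w+U<W : ∀ {w} → w ≤ M → w + U < W
  w+U<W w≤M = s≤s (+-monoˡ-≤ U w≤M)
  5≤Tbl : 5 ≤ Tbl
  5≤Tbl = ≤ᵇ⇒≤ 5 (6 + M) _
  Tbl<U : Tbl < U
  Tbl<U = ≤-trans (s≤s (m≤m+n Tbl 0)) (Tbl+v<U z≤n)
  U<W : U < W
  U<W = w+U<W z≤n

  entry : (ℕ → ℕ) → ℕ
  entry r = r 3 + suc (r 2)

  filled : (ℕ → ℕ) → ℕ → ℕ
  filled r i = if i ≡ᵇ entry r then r 2 else
               (if i ≡ᵇ 0 then entry r else (if i ≡ᵇ 2 then suc (r 2) else (if i ≡ᵇ 1 then r 2 else r i)))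

  filled-untouched : ∀ r {i} → 3 ≤ i → i ≢ entry r → filled r i ≡ r i
  filled-untouched r 3≤i i≢entry =
    trans (if-≡ᵇ-≢ i≢entry)
      (trans (if-≡ᵇ-≢ (low (s≤s z≤n))) (trans (if-≡ᵇ-≢ (low ≤-refl)) (if-≡ᵇ-≢ (low (s≤s (s≤s z≤n))))))
    where
    low : ∀ {k} → k < 3 → _ ≢ k
    low k<3 = >⇒≢ (<-≤-trans k<3 3≤i)

  iteration : ∀ a b r → r 2 ≤ M → Invariant r → InBound (cfg q a b r []) →
    Σ ℕ λ b′ → Steps (cfg q a b r []) 31 (cfg q 0 b′ (filled r) []) × Invariant (filled r)
      × filled r 2 ≡ suc (r 2)
  iteration a b r u≤M (base , zero-base , sentinel , u≤1+M , cells , table , zeros) bnd =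
    _ , Steps-trans probing (Steps-trans entering (Steps-trans filling looping)) , invariant′ , counter′
    where
    u = r 2
    ad = entry r
    ad≡ : ad ≡ Tbl + suc u
    ad≡ = cong (_+ suc u) base
    Tbl<ad : Tbl < ad
    Tbl<ad = subst (Tbl <_) (sym ad≡) (m<m+n Tbl (s≤s z≤n))
    ad<U : ad < U
    ad<U = subst (_< U) (sym ad≡) (Tbl+v<U (s≤s u≤M))
    3≤ad : 3 ≤ ad
    3≤ad = ≤-trans (≤ᵇ⇒≤ 3 5 _) (≤-trans 5≤Tbl (<⇒≤ Tbl<ad))
    ad≤ : ad ≤ Bd
    ad≤ = ≤-trans (<⇒≤ ad<U) U≤
    R4≤ : r 4 ≤ Bd
    R4≤ = subst (_≤ Bd) (sym zero-base) U≤
    probed : r (r 2 + r 4) ≡ 0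
    probed = trans (cong (λ z → r (r 2 + z)) zero-base) (zeros u u≤M)
    P≤ : r (r 2 + r 4) ≤ Bd
    P≤ = subst (_≤ Bd) (sym probed) z≤n
    u+R4≤ : r 2 + r 4 ≤ Bd
    u+R4≤ = subst (λ z → r 2 + z ≤ Bd) (sym zero-base) (≤-trans (<⇒≤ (w+U<W u≤M)) W≤)
    u≤ : u ≤ Bd
    u≤ = 1+M≤ u≤1+M
    1+u≤ : suc u ≤ Bd
    1+u≤ = 1+M≤ (s≤s u≤M)
    R3≤ : r 3 ≤ Bd
    R3≤ = subst (_≤ Bd) (sym base) Tbl≤
    probing = straight-line probe (cfg q a b r []) probe-placed _
      (bnd , (4≤ , proj₂ bnd) , (R4≤ , proj₂ bnd) , (R4≤ , R4≤) ,
       (2≤ , R4≤) , (u≤ , R4≤) , (u+R4≤ , R4≤) , (P≤ , R4≤))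
    entering = jump-taken probed enter-placed (P≤ , R4≤)
    filling = straight-line fill-entry (cfg (10 + q) (r (r 2 + r 4)) (r 4) r []) fill-placed _
      ((P≤ , R4≤) , (2≤ , R4≤) , (u≤ , R4≤) , (u≤ , u≤) , (1≤ , u≤) ,
       (1≤ , u≤) , (1+u≤ , u≤) , (1+u≤ , 1+u≤) , (2≤ , 1+u≤) ,
       (2≤ , 1+u≤) , (3≤ , 1+u≤) , (R3≤ , 1+u≤) ,
       (ad≤ , 1+u≤) , (ad≤ , ad≤) , (z≤n , ad≤) , (z≤n , ad≤) , (1≤ , ad≤) ,
       (u≤ , ad≤) , (u≤ , u≤) , (z≤n , u≤) , (ad≤ , u≤) , (ad≤ , u≤) , (z≤n , u≤))
    looping = jump-taken refl back-placed (z≤n , u≤)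
    r′ = filled r
    counter′ : r′ 2 ≡ suc u
    counter′ = if-≡ᵇ-≢ (<⇒≢ (<-≤-trans (≤ᵇ⇒≤ 3 3 _) 3≤ad))
    untouched : ∀ {i} → 3 ≤ i → i ≢ ad → r′ i ≡ r i
    untouched = filled-untouched r
    above : ∀ {i} → ad < i → r′ i ≡ r i
    above ad<i = untouched (≤-trans 3≤ad (<⇒≤ ad<i)) (>⇒≢ ad<i)
    table′ : ∀ v → v ≤ M → v ≤ r′ 2 → r′ (Tbl + v) ≡ v ∸ 1
    table′ v v≤M v≤ with m≤n⇒m<n∨m≡n (subst (v ≤_) counter′ v≤)
    ... | inj₁ v<1+u = trans (if-≡ᵇ-≢ (<⇒≢ (subst (Tbl + v <_) (sym ad≡) (+-monoʳ-< Tbl v<1+u))))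
                         (table v v≤M (s≤s⁻¹ v<1+u))
    ... | inj₂ refl  = if-≡ᵇ-≡ (sym ad≡)
    invariant′ : Invariant r′
    invariant′ =
      trans (untouched ≤-refl (<⇒≢ (<-≤-trans (≤ᵇ⇒≤ 4 5 _) (≤-trans 5≤Tbl (<⇒≤ Tbl<ad))))) base ,
      trans (untouched (≤ᵇ⇒≤ 3 4 _) (<⇒≢ (<-≤-trans ≤-refl (≤-trans 5≤Tbl (<⇒≤ Tbl<ad))))) zero-base ,
      trans (above (<-trans ad<U U<W)) sentinel ,
      subst (_≤ suc M) (sym counter′) (s≤s u≤M) ,
      (λ i i≤M → trans (untouched (≤ᵇ⇒≤ 3 (5 + i) _) (<⇒≢ (<-trans (+-monoʳ-< 5 (s≤s i≤M)) Tbl<ad)))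
                   (cells i i≤M)) ,
      table′ ,
      (λ w w≤M → trans (above (<-≤-trans ad<U (m≤n+m U w))) (zeros w w≤M))

  cleared : (ℕ → ℕ) → ℕ → ℕ
  cleared r i = if i ≡ᵇ 1 then 0 else r i

  exit : ∀ a b r → r 2 ≡ suc M → Invariant r → InBound (cfg q a b r []) →
    Steps (cfg q a b r []) 14 (cfg (37 + q) 0 0 (cleared r) [])
  exit a b r counter (_ , zero-base , sentinel , u≤1+M , _) bnd =
    Steps-trans probing (Steps-trans staying (Steps-trans zeroing (Steps-trans leaving clearing)))
    where
    R4≤ : r 4 ≤ Bd
    R4≤ = subst (_≤ Bd) (sym zero-base) U≤
    probed : r (r 2 + r 4) ≡ 1
    probed = trans (cong₂ (λ u z → r (u + z)) counter zero-base) sentinel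
    P≤ : r (r 2 + r 4) ≤ Bd
    P≤ = subst (_≤ Bd) (sym probed) (1≤)
    u+R4≤ : r 2 + r 4 ≤ Bd
    u+R4≤ = subst (_≤ Bd) (sym (cong₂ _+_ counter zero-base)) W≤
    u≤ : r 2 ≤ Bd
    u≤ = 1+M≤ u≤1+M
    probing = straight-line probe (cfg q a b r []) probe-placed _
      (bnd , (4≤ , proj₂ bnd) , (R4≤ , proj₂ bnd) , (R4≤ , R4≤) ,
       (2≤ , R4≤) , (u≤ , R4≤) , (u+R4≤ , R4≤) , (P≤ , R4≤))
    staying = jump-not-taken probed enter-placed (P≤ , R4≤)
    zeroing = straight-line (setA 0 ∷ []) (cfg (8 + q) (r (r 2 + r 4)) (r 4) r []) zero-placed _
      ((P≤ , R4≤) , (z≤n , R4≤))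
    leaving = jump-taken refl exit-placed (z≤n , R4≤)
    clearing = straight-line clear-saved-B (cfg (33 + q) 0 (r 4) r []) clear-placed _
      ((z≤n , R4≤) , (z≤n , z≤n) , (1≤ , z≤n) , (1≤ , z≤n) , (z≤n , z≤n))

  loop : ∀ k a b r → k + r 2 ≡ suc M → Invariant r → InBound (cfg q a b r []) →
    Σ (ℕ → ℕ) λ r′ → Steps (cfg q a b r []) (k * 31 + 14) (cfg (37 + q) 0 0 (cleared r′) [])
      × Invariant r′ × r′ 2 ≡ suc M
  loop zero    a b r counter inv bnd = r , exit a b r counter inv bnd , inv , counter
  loop (suc k) a b r k+1+u≡ inv bnd
    with iteration a b r (subst (r 2 ≤_) (suc-injective k+1+u≡) (m≤n+m (r 2) k)) inv bnd
  ... | b′ , once , inv′ , counter′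
    with loop k 0 b′ (filled r) (trans (cong (k +_) counter′) (trans (+-suc k (r 2)) k+1+u≡)) inv′
           (Steps-InBound once)
  ... | r′ , rest , inv″ , counter″ =
    r′ , subst (λ n → Steps (cfg q a b r []) n (cfg (37 + q) 0 0 (cleared r′) [])) (sym (+-assoc 31 (k * 31) 14))
           (Steps-trans once rest) ,
    inv″ , counter″

read-size : List (Instr Plus)
read-size = readN ∷ movB ∷ setA 1 ∷ apply plus ∷ movB ∷ setA 0 ∷ []

table-setup : List (Instr Plus)
table-setup = movB ∷ setA 2 ∷ store ∷ setA 6 ∷ apply plus ∷ movB ∷ setA 3 ∷ store ∷ setA 2 ∷ load ∷
              apply plus ∷ movB ∷ setA 2 ∷ apply plus ∷ movB ∷ setA 4 ∷ store ∷ setA 2 ∷ load ∷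
              apply plus ∷ movB ∷ setA 1 ∷ apply plus ∷ movB ∷ setA 0 ∷ store ∷ setA 1 ∷ movB ∷
              setA 0 ∷ load ∷ store ∷ setA 0 ∷ movB ∷ setA 2 ∷ store ∷ []

loop-start : ℕ → ℕ
loop-start K = 35 + (suc K + 6)

-- Reads N, computes M = (K + 1)(N + 1) by K + 1 additions, then builds the predecessor table up to M
prologue : ℕ → List (Instr Plus)
prologue K = read-size ++ (replicate (suc K) (apply plus) ++ (table-setup ++ table-loop (loop-start K)))

multiply : ∀ {Q : Program Plus} {N inp bound} k {p a b r o} → Placed Q p (replicate k (apply plus)) →
  (∀ j → j ≤ k → a + j * b ≤ bound) → b ≤ bound →
  Σ ℕ λ a′ → a′ ≡ a + k * b × Execution.Steps Q N inp bound (cfg p a b r o) k (cfg (k + p) a′ b r o)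
multiply {bound = bound} zero {a = a} _ partial≤ b≤ =
  a , sym (+-identityʳ a) , Execution.done (subst (_≤ bound) (+-identityʳ a) (partial≤ 0 z≤n) , b≤)
multiply {Q} {N} {inp} {bound} (suc k) {p} {a} {b} {r} {o} pl partial≤ b≤
  with multiply k (Placed-tail pl)
         (λ j j≤k → subst (_≤ bound) (sym (+-assoc a b (j * b))) (partial≤ (suc j) (s≤s j≤k))) b≤
... | a′ , a′≡ , steps =
  a′ , trans a′≡ (+-assoc a b (k * b)) ,
  Execution.next (subst (_≤ bound) (+-identityʳ a) (partial≤ 0 z≤n) , b≤) (Placed-here pl)
    (subst (λ z → Execution.Steps Q N inp bound (cfg (suc p) (a + b) b r o) k (cfg z a′ b r o)) (+-suc k p) steps)

module Prologue (K N : ℕ) (inp : ℕ → ℕ) (Q : Program Plus) (placed : Placed Q 0 (prologue K)) where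
  M = suc K * suc N
  q = loop-start K

  read-placed : Placed Q 0 read-size
  read-placed = Placed-++ˡ read-size _ placed
  after-read : Placed Q 6 (replicate (suc K) (apply plus) ++ (table-setup ++ table-loop q))
  after-read = Placed-++ʳ read-size _ placed
  multiply-placed : Placed Q 6 (replicate (suc K) (apply plus))
  multiply-placed = Placed-++ˡ (replicate (suc K) (apply plus)) _ after-read
  after-multiply : Placed Q (suc K + 6) (table-setup ++ table-loop q)
  after-multiply = subst (λ z → Placed Q (z + 6) (table-setup ++ table-loop q)) (length-replicate (suc K))
                     (Placed-++ʳ (replicate (suc K) (apply plus)) _ after-read)
  setup-placed : Placed Q (suc K + 6) table-setup
  setup-placed = Placed-++ˡ table-setup _ after-multiply
  loop-placed : Placed Q q (table-loop q)
  loop-placed = Placed-++ʳ table-setup _ after-multiply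

  open TableLoop Q N inp M q loop-placed public
  open Execution Q N inp Bd

  setup-start : Config
  setup-start = cfg (suc K + 6) M (suc N) (λ _ → 0) []

  r₀ : ℕ → ℕ
  r₀ = R (run-straight table-setup setup-start)

  5≤W : 5 ≤ W
  5≤W = ≤-trans 5≤Tbl (<⇒≤ (<-trans Tbl<U U<W))

  setup-untouched : ∀ {i} → 5 ≤ i → i ≢ W → r₀ i ≡ 0
  setup-untouched 5≤i i≢W =
    trans (if-≡ᵇ-≢ (low 2<5)) (trans (if-≡ᵇ-≢ i≢W) (trans (if-≡ᵇ-≢ (low 0<5))
      (trans (if-≡ᵇ-≢ (low 4<5)) (trans (if-≡ᵇ-≢ (low 3<5)) (if-≡ᵇ-≢ (low 2<5))))))
    where
    low : ∀ {k} → k < 5 → _ ≢ k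
    low k<5 = >⇒≢ (<-≤-trans k<5 5≤i)
    0<5 = ≤ᵇ⇒≤ 1 5 _
    2<5 = ≤ᵇ⇒≤ 3 5 _
    3<5 = ≤ᵇ⇒≤ 4 5 _
    4<5 = ≤ᵇ⇒≤ 5 5 _

  setup-invariant : Invariant r₀
  setup-invariant =
    if-≡ᵇ-≢ (<⇒≢ (<-≤-trans (≤ᵇ⇒≤ 4 5 _) 5≤W)) ,
    if-≡ᵇ-≢ (<⇒≢ (<-≤-trans ≤-refl 5≤W)) ,
    trans (if-≡ᵇ-≢ (>⇒≢ (<-≤-trans (≤ᵇ⇒≤ 3 5 _) 5≤W))) (if-≡ᵇ-≡ {i = W} {a = W} refl) ,
    z≤n ,
    (λ i i≤M → setup-untouched (m≤m+n 5 i) (<⇒≢ (<-trans (+-monoʳ-< 5 (s≤s i≤M)) (<-trans Tbl<U U<W)))) ,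
    (λ { .0 _ z≤n → setup-untouched (≤-trans 5≤Tbl (m≤m+n Tbl 0)) (<⇒≢ (<-trans (Tbl+v<U z≤n) U<W)) }) ,
    (λ w w≤M → setup-untouched (≤-trans 5≤Tbl (≤-trans (<⇒≤ Tbl<U) (m≤n+m U w))) (<⇒≢ (w+U<W w≤M)))

  M≤ : M ≤ Bd
  M≤ = 1+M≤ (n≤1+n M)
  1+N≤ : suc N ≤ Bd
  1+N≤ = 1+M≤ (≤-trans (m≤m+n (suc N) (K * suc N)) (n≤1+n M))
  N≤ : N ≤ Bd
  N≤ = ≤-trans (n≤1+n N) 1+N≤
  M+Tbl≤ : M + Tbl ≤ Bd
  M+Tbl≤ = ≤-trans (≤-trans (n≤1+n _) (n≤1+n _)) U≤
  M+U≤ : M + U ≤ Bd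
  M+U≤ = ≤-trans (n≤1+n _) W≤

  prologue-length : ℕ
  prologue-length = 6 + (suc K + (35 + (suc M * 31 + 14)))

  reading : Steps initConfig 6 (cfg 6 0 (suc N) (λ _ → 0) [])
  reading = straight-line read-size initConfig read-placed _
      ((z≤n , z≤n) , (N≤ , z≤n) , (N≤ , N≤) , (1≤ , N≤) , (1+N≤ , N≤) , (1+N≤ , 1+N≤) , (z≤n , 1+N≤))

  setting-up : Steps setup-start 35 (cfg q 2 0 r₀ [])
  setting-up = straight-line table-setup setup-start setup-placed _
      ((M≤ , 1+N≤) , (M≤ , M≤) , (2≤ , M≤) , (2≤ , M≤) , (6≤ ≤-refl , M≤) , (Tbl≤ , M≤) , (Tbl≤ , Tbl≤) ,
       (3≤ , Tbl≤) , (3≤ , Tbl≤) , (2≤ , Tbl≤) , (M≤ , Tbl≤) , (M+Tbl≤ , Tbl≤) , (M+Tbl≤ , M+Tbl≤) ,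
       (2≤ , M+Tbl≤) , (U≤ , M+Tbl≤) , (U≤ , U≤) , (4≤ , U≤) , (4≤ , U≤) , (2≤ , U≤) , (M≤ , U≤) ,
       (M+U≤ , U≤) , (M+U≤ , M+U≤) , (1≤ , M+U≤) , (W≤ , M+U≤) , (W≤ , W≤) , (z≤n , W≤) , (z≤n , W≤) ,
       (1≤ , W≤) , (1≤ , 1≤) , (z≤n , 1≤) , (W≤ , 1≤) , (W≤ , 1≤) , (z≤n , 1≤) , (z≤n , z≤n) , (2≤ , z≤n) ,
       (2≤ , z≤n))

  multiplying : Steps (cfg 6 0 (suc N) (λ _ → 0) []) (suc K) setup-start
  multiplying with multiply (suc K) multiply-placed (λ j j≤ → ≤-trans (*-monoˡ-≤ (suc N) j≤) M≤) 1+N≤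
  ... | _ , refl , steps = steps


  looped : Σ (ℕ → ℕ) λ r′ → Steps (cfg q 2 0 r₀ []) (suc M * 31 + 14) (cfg (37 + q) 0 0 (cleared r′) [])
             × Invariant r′ × r′ 2 ≡ suc M
  looped = loop (suc M) 2 0 r₀ (+-identityʳ (suc M)) setup-invariant (2≤ , z≤n)

  run-prologue : Σ (ℕ → ℕ) λ r′ →
    Steps initConfig prologue-length (cfg (37 + q) 0 0 (cleared r′) []) × Invariant r′ × r′ 2 ≡ suc M
  run-prologue =
    proj₁ looped , Steps-trans reading (Steps-trans multiplying (Steps-trans setting-up (proj₁ (proj₂ looped)))) ,
    proj₂ (proj₂ looped)

-- Simulating both phases

length-prologue : ∀ K → length (prologue K) ≡ 37 + loop-start K
length-prologue K = begin
  length (prologue K)                     ≡⟨ length-++ read-size {additions ++ tables} ⟩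
  6 + length (additions ++ tables)        ≡⟨ cong (6 +_) (length-++ additions {tables}) ⟩
  6 + (length additions + 72)             ≡⟨ cong (λ n → 6 + (n + 72)) (length-replicate (suc K)) ⟩
  6 + (suc K + 72)                        ≡⟨ arithmetic K ⟩
  37 + loop-start K                       ∎
  where
  open ≡-Reasoning
  additions = replicate (suc K) (apply plus)
  tables = table-setup ++ table-loop (loop-start K)
  arithmetic : ∀ K → 6 + ((1 + K) + 72) ≡ 37 + (35 + ((1 + K) + 6))
  arithmetic = solve-∀

space : ℕ → ℕ
space M = suc (1 + (M + (2 + (M + (6 + M)))))

6+M+M≤space : ∀ M → 6 + M + M ≤ space M
6+M+M≤space M = subst (6 + M + M ≤_) (sym (space≡ M)) (m≤m+n _ _)
  where
  space≡ : ∀ M → suc (1 + (M + (2 + (M + (6 + M))))) ≡ 6 + M + M + (4 + M)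
  space≡ = solve-∀

space≤ : ∀ K N → space (suc K * suc N) ≤ 200 * suc K * suc N
space≤ K N = subst (space (suc K * suc N) ≤_) (sym (room K N)) (m≤m+n _ _)
  where
  room : ∀ K N → 200 * suc K * suc N ≡
    suc (1 + (suc K * suc N + (2 + (suc K * suc N + (6 + suc K * suc N))))) + (187 + 197 * N + 197 * K + 197 * (K * N))
  room = solve-∀

preprocessing-time≤ : ∀ K N {t} → t ≤ K * suc N →
  6 + (suc K + (35 + (suc (suc K * suc N) * 31 + 14))) + (16 * t + 4) ≤ 200 * suc K * suc N
preprocessing-time≤ K N t≤ =
  ≤-trans (+-monoʳ-≤ prologue-time (+-monoˡ-≤ 4 (*-monoʳ-≤ 16 t≤)))
    (subst (prologue-time + (16 * (K * suc N) + 4) ≤_) (sym (room K N)) (m≤m+n _ _))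
  where
  prologue-time = 6 + (suc K + (35 + (suc (suc K * suc N) * 31 + 14)))
  room : ∀ K N → 200 * suc K * suc N ≡
    6 + (suc K + (35 + (suc (suc K * suc N) * 31 + 14))) + (16 * (K * suc N) + 4)
      + (78 + 169 * N + 152 * K + 153 * (K * N))
  room = solve-∀

query-time≤ : ∀ K {t} → t ≤ K → 16 * t ≤ 200 * suc K
query-time≤ K t≤K = ≤-trans (*-monoʳ-≤ 16 (≤-trans t≤K (n≤1+n K))) (*-monoˡ-≤ (suc K) (m≤m+n 16 184))

-- The simulated final B may be nonzero, but the query phase starts with B = 0: reset its copy R′[1].
epilogue : List (Instr Plus)
epilogue = setA 0 ∷ movB ∷ setA 1 ∷ store ∷ []

preprocessing-pc : ℕ → Program SuccPred → ℕ → ℕ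
preprocessing-pc K P ℓ = block-start P ℓ + length (prologue K)

compile-preprocessing : ℕ → Program SuccPred → Program Plus
compile-preprocessing K P = prologue K ++ (compile (preprocessing-pc K P) P ++ epilogue)

compile-query : Program SuccPred → Program Plus
compile-query P = compile (block-start P) P

module PreprocessingSimulation (P : Program SuccPred) (K N : ℕ) (inp : ℕ → ℕ) where
  M = suc K * suc N
  tr = preprocessing-pc K P
  program = compile-preprocessing K P

  block-placed : ∀ p {i} → fetch P p ≡ just i → Placed program (tr p) (compile-instr tr i)
  block-placed p {i} eq =
    subst (λ n → Placed program n (compile-instr tr i)) (+-comm (length (prologue K)) (block-start P p))
      (Placed-inʳ (prologue K) (compile tr P ++ epilogue)
        (Placed-inˡ (compile tr P) epilogue (compile-instr-placed tr P p eq)))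

  tr-suc : ∀ p {i} → fetch P p ≡ just i → tr (suc p) ≡ block-length i + tr p
  tr-suc p {i} eq = trans (cong (_+ length (prologue K)) (block-start-suc P p eq))
    (+-assoc (block-length i) (block-start P p) (length (prologue K)))

  open Simulation M
  open Blocks program N inp (space M) (6+M+M≤space M) tr
  open SimulateRun P block-placed tr-suc
  module Pro = Prologue K N inp program (Placed-inˡ (prologue K) _ (Placed-self (prologue K)))

  epilogue-start : ℕ
  epilogue-start = length (prologue K) + length (compile tr P)

  epilogue-placed : Placed program epilogue-start epilogue
  epilogue-placed = subst (λ n → Placed program (length (prologue K) + n) epilogue) (+-identityʳ _)
    (Placed-inʳ (prologue K) _ (Placed-inʳ (compile tr P) epilogue (Placed-self epilogue)))

  length-program : length program ≡ 4 + epilogue-start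
  length-program =
    trans (length-++ (prologue K)) (trans (cong (length (prologue K) +_) (length-++ (compile tr P)))
      (trans (sym (+-assoc (length (prologue K)) _ 4)) (+-comm _ 4)))

  halted-at-epilogue : ∀ c → Halted P c → tr (pc c) ≡ epilogue-start
  halted-at-epilogue c halted =
    trans (cong (_+ length (prologue K)) (block-start-halted tr P (pc c) halted)) (+-comm _ (length (prologue K)))

  after-prologue : Config
  after-prologue = cfg (37 + Pro.q) 0 0 (Pro.cleared (proj₁ Pro.run-prologue)) []

  start : Simulates tr initConfig after-prologue
  start = simulates (sym (length-prologue K)) refl refl refl
    (refl , base , cells , λ v v≤M → table v v≤M (subst (v ≤_) (sym counter) (≤-trans v≤M (n≤1+n M))))
    where
    inv = proj₁ (proj₂ (proj₂ Pro.run-prologue))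
    counter = proj₂ (proj₂ (proj₂ Pro.run-prologue))
    base = proj₁ inv
    cells = proj₁ (proj₂ (proj₂ (proj₂ (proj₂ inv))))
    table = proj₁ (proj₂ (proj₂ (proj₂ (proj₂ (proj₂ inv)))))

  Preprocessed : ℕ → Set
  Preprocessed t = Σ Config λ σ′ → Σ ℕ λ k → k ≤ Pro.prologue-length + (16 * t + 4) × Steps initConfig k σ′
    × Halted program σ′ × Represents 0 (R σ′) (R (run-succ t initConfig))

  preprocess : ∀ t → SmallFor t initConfig → Halted P (run-succ t initConfig) → Preprocessed t
  preprocess t small halted = finish (simulate t initConfig after-prologue start small)
    where
    finish : Simulated t initConfig after-prologue → Preprocessed t
    finish (cfg p a b r o , k , k≤ , steps , simulates pc≡ A≡ B≡ _ (_ , base , cells , table)) =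
      _ , Pro.prologue-length + (k + 4) , +-monoʳ-≤ Pro.prologue-length (+-monoˡ-≤ 4 k≤) ,
      Steps-trans (proj₁ (proj₂ Pro.run-prologue)) (Steps-trans steps finishing) ,
      fetch-beyond program (≤-reflexive (trans length-program (cong (4 +_) (sym at-epilogue)))) ,
      (refl , base , cells , table)
      where
      at-epilogue : p ≡ epilogue-start
      at-epilogue = trans pc≡ (halted-at-epilogue (run-succ t initConfig) halted)
      a≤ : a ≤ space M
      a≤ = subst (_≤ space M) (sym A≡) (M≤ (proj₁ (small t ≤-refl)))
      b≤ : b ≤ space M
      b≤ = subst (_≤ space M) (sym B≡) (M≤ (proj₂ (small t ≤-refl)))
      finishing = straight-line epilogue (cfg p a b r o)
        (subst (λ n → Placed program n epilogue) (sym at-epilogue) epilogue-placed) _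
        ((a≤ , b≤) , (z≤n , b≤) , (z≤n , z≤n) , (1≤ , z≤n) , (1≤ , z≤n))

module QuerySimulation (P : Program SuccPred) (K N : ℕ) (inp : ℕ → ℕ) where
  M = suc K * suc N
  program = compile-query P

  open Simulation M
  open Blocks program N inp (space M) (6+M+M≤space M) (block-start P)
  open SimulateRun P (compile-instr-placed (block-start P) P) (block-start-suc P)

  answer : ∀ r′ r t → Represents 0 r′ r → SmallFor t (cfg 0 0 0 r []) → Halted P (run-succ t (cfg 0 0 0 r [])) →
    Σ Config λ τ′ → Σ ℕ λ k → k ≤ 16 * t × Steps (cfg 0 0 0 r′ []) k τ′ × Halted program τ′
      × outs τ′ ≡ outs (run-succ t (cfg 0 0 0 r []))
  answer r′ r t rep small halted =
    let (τ′ , k , k≤ , steps , sim) = simulate t (cfg 0 0 0 r []) (cfg 0 0 0 r′ []) (simulates refl refl refl refl rep) small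
    in τ′ , k , k≤ , steps ,
       fetch-beyond program (≤-reflexive (sym (trans (Simulates.pc≡ sim) (block-start-halted _ P _ halted)))) ,
       Simulates.outs≡ sim

small-bound : ∀ K N {v} → v ≤ K * suc N → v ≤ suc K * suc N
small-bound K N v≤ = ≤-trans v≤ (m≤n+m (K * suc N) (suc N))

preprocessing-simulated : ∀ P K {N inp σ} → RunsTo SuccPred P N inp initConfig (K * suc N) (K * suc N) σ →
  Σ Config λ σ′ → RunsTo Plus (compile-preprocessing K P) N inp initConfig (200 * suc K * suc N) (200 * suc K * suc N) σ′
    × Simulation.Represents (suc K * suc N) 0 (R σ′) (R σ)
preprocessing-simulated P K {N} {inp} (t , t≤ , halted , run≡σ , bounds) =
  let (σ′ , k , k≤ , steps , halted′ , rep) = preprocess t small halted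
  in σ′ , Steps⇒RunsTo steps (≤-trans k≤ (preprocessing-time≤ K N t≤)) (space≤ K N) halted′ ,
     subst (λ σ → Simulation.Represents (suc K * suc N) 0 (R σ′) (R σ)) run≡σ rep
  where
  open PreprocessingSimulation P K N inp
  open Execution program N inp (space M) using (Steps⇒RunsTo)
  small : ∀ s → s ≤ t → Simulation.Small M (run SuccPred P N inp s initConfig)
  small s s≤t = small-bound K N (proj₁ (bounds s s≤t)) , small-bound K N (proj₂ (bounds s s≤t))

query-simulated : ∀ P K {N inp r r′ τ} → Simulation.Represents (suc K * suc N) 0 r′ r →
  RunsTo SuccPred P N inp (cfg 0 0 0 r []) K (K * suc N) τ →
  Σ Config λ τ′ → RunsTo Plus (compile-query P) N inp (cfg 0 0 0 r′ []) (200 * suc K) (200 * suc K * suc N) τ′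
    × outs τ′ ≡ outs τ
query-simulated P K {N} {inp} {r} {r′} rep (t , t≤K , halted , run≡τ , bounds) =
  let (τ′ , k , k≤ , steps , halted′ , outs≡) = answer r′ r t rep small halted
  in τ′ , Steps⇒RunsTo steps (≤-trans k≤ (query-time≤ K t≤K)) (space≤ K N) halted′ ,
     trans outs≡ (cong outs run≡τ)
  where
  open QuerySimulation P K N inp
  open Execution program N inp (space M) using (Steps⇒RunsTo)
  small : ∀ s → s ≤ t → Simulation.Small M (run SuccPred P N inp s (cfg 0 0 0 r []))
  small s s≤t = small-bound K N (proj₁ (bounds s s≤t)) , small-bound K N (proj₂ (bounds s s≤t))

CONST-LIN-succ⊆CONST-LIN : ∀ c d (f : Problem d) → CONST-LIN-succ c d f → CONST-LIN c d f
CONST-LIN-succ⊆CONST-LIN c d f (P₁ , P₂ , K , solves) =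
  compile-preprocessing K P₁ , compile-query P₂ , 200 * suc K , λ N I I≤ →
    let (σ , preprocessed , answers) = solves N I I≤
        (σ′ , preprocessed′ , rep) = preprocessing-simulated P₁ K preprocessed
    in σ′ , preprocessed′ , λ X X≤ →
         let (τ , answered , outs≡) = answers X X≤
             (τ′ , answered′ , outs′≡) = query-simulated P₂ K rep answered
         in τ′ , answered′ , trans outs′≡ outs≡

corollary10p4 : ((c d : ℕ) (f : Problem d) → CONST-LIN-succ c d f → CONST-LIN c d f)
    × (Σ ℕ λ c → Σ ℕ λ d → Σ (Problem d) λ f → CONST-LIN c d f × ¬ CONST-LIN-succ c d f)
corollary10p4 = CONST-LIN-succ⊆CONST-LIN , 1 , 2 , sum-problem , sum∈CONST-LIN , sum∉CONST-LIN-succ
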